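{- Let $\mathbf r=(r_1,r_2,r_3)\in\mathcal R$ and $j\in\{1,2,3\}$. Then $\eta:=\frac{\sigma_1}{r_j}+\frac{\ell\sigma_3}{r_j^2}$ is an integer with $\eta\ge2$, and this bound is sharp: for $j=3$ one has $\eta=2$ both for $\mathbf r=(1,2,3)$ (where $\ell=0$) and for $\mathbf r=(1,2,7)$ (where $\ell\ne0$).
   Context: $\mathcal R$ is the set of triples $\mathbf r=(r_1,r_2,r_3)$ of pairwise coprime positive integers with $r_1<r_2<r_3$; for such $\mathbf r$, $\sigma_1=r_1+r_2+r_3$, $\sigma_2=r_1r_2+r_1r_3+r_2r_3$, $\sigma_3=r_1r_2r_3$, and $\ell$ is the unique integer with $0\le\ell<\sigma_3$ and $\ell\sigma_2\equiv-\sigma_1\pmod{\sigma_3}$. -}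

module Defs where

open import Data.Nat using (ℕ; _+_; _*_; _<_)
open import Data.Nat.Divisibility using (_∣_)
open import Data.Nat.Coprimality using (Coprime)
open import Data.Fin using (Fin; zero; suc)
open import Data.Product using (_×_)

InR : ℕ → ℕ → ℕ → Set
InR r₁ r₂ r₃ =
  0 < r₁ × r₁ < r₂ × r₂ < r₃ ×
  Coprime r₁ r₂ × Coprime r₁ r₃ × Coprime r₂ r₃

σ₁ σ₂ σ₃ : ℕ → ℕ → ℕ → ℕ
σ₁ r₁ r₂ r₃ = r₁ + r₂ + r₃
σ₂ r₁ r₂ r₃ = r₁ * r₂ + r₁ * r₃ + r₂ * r₃
σ₃ r₁ r₂ r₃ = r₁ * r₂ * r₃

-- ℓ is characterised by 0 ≤ ℓ < σ₃ and ℓ σ₂ ≡ -σ₁ (mod σ₃),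
-- i.e. σ₃ ∣ ℓ σ₂ + σ₁ (ℓ ∈ ℕ gives 0 ≤ ℓ).
IsEll : ℕ → ℕ → ℕ → ℕ → Set
IsEll r₁ r₂ r₃ ℓ =
  ℓ < σ₃ r₁ r₂ r₃ × σ₃ r₁ r₂ r₃ ∣ ℓ * σ₂ r₁ r₂ r₃ + σ₁ r₁ r₂ r₃

sel : ℕ → ℕ → ℕ → Fin 3 → ℕ
sel r₁ r₂ r₃ zero = r₁
sel r₁ r₂ r₃ (suc zero) = r₂
sel r₁ r₂ r₃ (suc (suc zero)) = r₃

{-# OPTIONS --safe #-}
module Submission where

-- Write r = r_j and σ₃ = r P with P the product of the other two entries. Then
-- σ₂ = r c + P with c their sum, so from σ₃ ∣ ℓσ₂ + σ₁ we get r ∣ ℓP + σ₁, and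
-- η = (ℓP + σ₁)/r satisfies η r² = σ₁ r + ℓσ₃. Since r < σ₁ ≤ η r, η ≥ 2.

open import Defs
open import Data.Nat using (ℕ; zero; suc; _+_; _*_; _≤_; _<_; z≤n; s≤s; _≟_; _<?_)
open import Data.Nat.Properties using (m≤n+m; m≤m+n; m<m+n; m<n+m; <-≤-trans; <-trans; +-identityʳ; <-irrefl; *-assoc)
open import Data.Nat.Divisibility using (_∣_; divides; _∣?_; ∣m+n∣m⇒∣n; ∣-trans; m∣m*n)
open import Data.Nat.Coprimality using (coprime?)
open import Data.Nat.Tactic.RingSolver using (solve-∀)
open import Data.Fin using (Fin; zero; suc; toℕ; fromℕ<)
open import Data.Fin.Properties using (all?; toℕ-fromℕ<)
open import Data.Product using (_×_; ∃-syntax; _,_)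
open import Data.Empty using (⊥-elim)
open import Relation.Binary.PropositionalEquality using (_≡_; _≢_; refl; sym; trans; cong; subst; module ≡-Reasoning)
open import Relation.Nullary using (Dec)
open import Relation.Nullary.Decidable using (True; toWitness; _×-dec_; _→-dec_)
open import Relation.Unary using (Pred; Decidable)

m<n≤q*m⇒2≤q : ∀ {m n} q → m < n → n ≤ q * m → 2 ≤ q
m<n≤q*m⇒2≤q zero          m<n n≤0   = ⊥-elim (<-irrefl refl (<-≤-trans (<-≤-trans (s≤s z≤n) m<n) n≤0))
m<n≤q*m⇒2≤q {m} 1         m<n n≤m+0 = ⊥-elim (<-irrefl refl (<-≤-trans m<n (subst (_ ≤_) (+-identityʳ m) n≤m+0)))
m<n≤q*m⇒2≤q (suc (suc q)) _   _     = s≤s (s≤s z≤n)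

r*P∣⇒r∣ℓ*P+s : ∀ r P c s ℓ → r * P ∣ ℓ * (r * c + P) + s → r ∣ ℓ * P + s
r*P∣⇒r∣ℓ*P+s r P c s ℓ rP∣ = ∣m+n∣m⇒∣n r∣split (m∣m*n (ℓ * c))
  where
  split : ∀ ℓ r c P s → ℓ * (r * c + P) + s ≡ r * (ℓ * c) + (ℓ * P + s)
  split = solve-∀
  r∣split : r ∣ r * (ℓ * c) + (ℓ * P + s)
  r∣split = subst (r ∣_) (split ℓ r c P s) (∣-trans (m∣m*n P) rP∣)

quotient-bound : ∀ r P c s₁ s₂ s₃ ℓ → s₃ ≡ r * P → s₂ ≡ r * c + P → r < s₁ →
  s₃ ∣ ℓ * s₂ + s₁ → ∃[ η ] (η * (r * r) ≡ s₁ * r + ℓ * s₃ × 2 ≤ η)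
quotient-bound r P c s₁ s₂ s₃ ℓ refl refl r<s₁ s₃∣ with r*P∣⇒r∣ℓ*P+s r P c s₁ ℓ s₃∣
... | divides η ℓP+s₁≡ηr = η , scaled , m<n≤q*m⇒2≤q η r<s₁ s₁≤ηr
  where
  open ≡-Reasoning
  scaled : η * (r * r) ≡ s₁ * r + ℓ * (r * P)
  scaled = begin
    η * (r * r)            ≡⟨ sym (*-assoc η r r) ⟩
    η * r * r              ≡⟨ cong (_* r) (sym ℓP+s₁≡ηr) ⟩
    (ℓ * P + s₁) * r       ≡⟨ expand ℓ P s₁ r ⟩
    s₁ * r + ℓ * (r * P)   ∎
    where
    expand : ∀ ℓ P s₁ r → (ℓ * P + s₁) * r ≡ s₁ * r + ℓ * (r * P)
    expand = solve-∀
  s₁≤ηr : s₁ ≤ η * r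
  s₁≤ηr = subst (s₁ ≤_) ℓP+s₁≡ηr (m≤n+m s₁ (ℓ * P))

cofactor coSum : ℕ → ℕ → ℕ → Fin 3 → ℕ
cofactor r₁ r₂ r₃ zero             = r₂ * r₃
cofactor r₁ r₂ r₃ (suc zero)       = r₁ * r₃
cofactor r₁ r₂ r₃ (suc (suc zero)) = r₁ * r₂
coSum r₁ r₂ r₃ zero             = r₂ + r₃
coSum r₁ r₂ r₃ (suc zero)       = r₁ + r₃
coSum r₁ r₂ r₃ (suc (suc zero)) = r₁ + r₂

σ₃≡sel*cofactor : ∀ j r₁ r₂ r₃ → σ₃ r₁ r₂ r₃ ≡ sel r₁ r₂ r₃ j * cofactor r₁ r₂ r₃ j
σ₃≡sel*cofactor zero             = *-assoc
σ₃≡sel*cofactor (suc zero)       = rearrange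
  where
  rearrange : ∀ a b c → a * b * c ≡ b * (a * c)
  rearrange = solve-∀
σ₃≡sel*cofactor (suc (suc zero)) = rearrange
  where
  rearrange : ∀ a b c → a * b * c ≡ c * (a * b)
  rearrange = solve-∀

σ₂≡sel*coSum+cofactor : ∀ j r₁ r₂ r₃ →
  σ₂ r₁ r₂ r₃ ≡ sel r₁ r₂ r₃ j * coSum r₁ r₂ r₃ j + cofactor r₁ r₂ r₃ j
σ₂≡sel*coSum+cofactor zero             = rearrange
  where
  rearrange : ∀ a b c → a * b + a * c + b * c ≡ a * (b + c) + b * c
  rearrange = solve-∀
σ₂≡sel*coSum+cofactor (suc zero)       = rearrange
  where
  rearrange : ∀ a b c → a * b + a * c + b * c ≡ b * (a + c) + a * c
  rearrange = solve-∀
σ₂≡sel*coSum+cofactor (suc (suc zero)) = rearrange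
  where
  rearrange : ∀ a b c → a * b + a * c + b * c ≡ c * (a + b) + a * b
  rearrange = solve-∀

sel<σ₁ : ∀ {r₁ r₂ r₃} → InR r₁ r₂ r₃ → ∀ j → sel r₁ r₂ r₃ j < σ₁ r₁ r₂ r₃
sel<σ₁ {r₁} {r₂} {r₃} (0<r₁ , r₁<r₂ , _) zero =
  <-≤-trans (m<m+n r₁ (<-trans 0<r₁ r₁<r₂)) (m≤m+n (r₁ + r₂) r₃)
sel<σ₁ {r₁} {r₂} {r₃} (0<r₁ , _) (suc zero) =
  <-≤-trans (m<n+m r₂ 0<r₁) (m≤m+n (r₁ + r₂) r₃)
sel<σ₁ {r₁} {r₂} {r₃} (0<r₁ , _) (suc (suc zero)) =
  m<n+m r₃ (<-≤-trans 0<r₁ (m≤m+n r₁ r₂))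

InR? : ∀ r₁ r₂ r₃ → Dec (InR r₁ r₂ r₃)
InR? r₁ r₂ r₃ = 0 <? r₁ ×-dec r₁ <? r₂ ×-dec r₂ <? r₃ ×-dec
  coprime? r₁ r₂ ×-dec coprime? r₁ r₃ ×-dec coprime? r₂ r₃

unique-below : ∀ {p} n k {P : Pred ℕ p} (P? : Decidable P) →
  True (all? (λ (i : Fin n) → P? (toℕ i) →-dec toℕ i ≟ k)) →
  ∀ m → m < n → P m → m ≡ k
unique-below n k {P} P? checked m m<n Pm =
  trans m≡i (toWitness checked (fromℕ< m<n) (subst P m≡i Pm))
  where
  m≡i : m ≡ toℕ (fromℕ< m<n)
  m≡i = sym (toℕ-fromℕ< m<n)

IsEll-unique : ∀ r₁ r₂ r₃ k →
  True (all? (λ (i : Fin (σ₃ r₁ r₂ r₃)) →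
    σ₃ r₁ r₂ r₃ ∣? toℕ i * σ₂ r₁ r₂ r₃ + σ₁ r₁ r₂ r₃ →-dec toℕ i ≟ k)) →
  ∀ ℓ → IsEll r₁ r₂ r₃ ℓ → ℓ ≡ k
IsEll-unique r₁ r₂ r₃ k checked ℓ (ℓ<σ₃ , σ₃∣) =
  unique-below _ k (λ ℓ → σ₃ r₁ r₂ r₃ ∣? ℓ * σ₂ r₁ r₂ r₃ + σ₁ r₁ r₂ r₃) checked ℓ ℓ<σ₃ σ₃∣

ℓ-of-123 : ∀ ℓ → IsEll 1 2 3 ℓ → ℓ ≡ 0
ℓ-of-123 = IsEll-unique 1 2 3 0 _

ℓ-of-127 : ∀ ℓ → IsEll 1 2 7 ℓ → ℓ ≡ 2
ℓ-of-127 = IsEll-unique 1 2 7 2 _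

lemma7p4 :
    ((r₁ r₂ r₃ : ℕ) → InR r₁ r₂ r₃ → (j : Fin 3) → (ℓ : ℕ) → IsEll r₁ r₂ r₃ ℓ →
      ∃[ η ] (η * (sel r₁ r₂ r₃ j * sel r₁ r₂ r₃ j)
                ≡ σ₁ r₁ r₂ r₃ * sel r₁ r₂ r₃ j + ℓ * σ₃ r₁ r₂ r₃
              × 2 ≤ η))
    × (InR 1 2 3 × ((ℓ : ℕ) → IsEll 1 2 3 ℓ →
         ℓ ≡ 0 × 2 * (3 * 3) ≡ σ₁ 1 2 3 * 3 + ℓ * σ₃ 1 2 3))
    × (InR 1 2 7 × ((ℓ : ℕ) → IsEll 1 2 7 ℓ →
         ℓ ≢ 0 × 2 * (7 * 7) ≡ σ₁ 1 2 7 * 7 + ℓ * σ₃ 1 2 7))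
lemma7p4 =
    (λ r₁ r₂ r₃ r∈R j ℓ → λ { (_ , σ₃∣) →
      quotient-bound _ _ _ _ _ _ ℓ (σ₃≡sel*cofactor j r₁ r₂ r₃)
        (σ₂≡sel*coSum+cofactor j r₁ r₂ r₃) (sel<σ₁ r∈R j) σ₃∣ })
  , (toWitness {a? = InR? 1 2 3} _ , λ ℓ isEll → let ℓ≡0 = ℓ-of-123 ℓ isEll in
      ℓ≡0 , cong (λ ℓ → σ₁ 1 2 3 * 3 + ℓ * σ₃ 1 2 3) (sym ℓ≡0))
  , (toWitness {a? = InR? 1 2 7} _ , λ ℓ isEll → let ℓ≡2 = ℓ-of-127 ℓ isEll in
      subst (_≢ 0) (sym ℓ≡2) (λ ()) , cong (λ ℓ → σ₁ 1 2 7 * 7 + ℓ * σ₃ 1 2 7) (sym ℓ≡2))
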